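{- Let $G$ be a finite simple connected graph with $|E(G)|>\nu_2(G)$ and $\nu_2(G)\ge 5$, and let $R$ be a maximum 2-packing of $G$. If the graph $G[R]$ is connected, then $\gamma(G)\le \nu_2(G)-2$.
   Context: A 2-packing of a graph $G$ is a set $R\subseteq E(G)$ such that no three edges of $R$ are incident with a common vertex; $\nu_2(G)$ is the maximum size of a 2-packing, and a maximum 2-packing is one of that size. $G[R]$ denotes the subgraph of $G$ formed by the edges of $R$ together with their endpoints. $\gamma(G)$ is the domination number: the minimum size of a set $D\subseteq V(G)$ such that every vertex is in $D$ or adjacent to a vertex of $D$. -}

module Defs where

open import Data.Nat using (ℕ; _≤_; _<_; _<?_)
open import Data.Bool using (Bool; true; false)
open import Data.Fin using (Fin; toℕ; _≟_)
open import Data.List using (List; length; filter; cartesianProduct; allFin)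
open import Data.List.Membership.Propositional using (_∈_)
open import Data.List.Relation.Unary.All using (All)
open import Data.List.Relation.Unary.Any using (Any)
open import Data.List.Relation.Unary.Unique.Propositional using (Unique)
open import Data.Product using (_×_; _,_; proj₁; proj₂; ∃)
open import Data.Sum using (_⊎_)
open import Relation.Binary.PropositionalEquality using (_≡_)
open import Relation.Nullary.Decidable using (_⊎-dec_; _×-dec_)
open import Relation.Binary.Construct.Closure.ReflexiveTransitive using (Star)
import Data.Bool as B

record Graph (n : ℕ) : Set where
  field
    Adj   : Fin n → Fin n → Bool
    sym   : ∀ u v → Adj u v ≡ Adj v u
    irrefl : ∀ u → Adj u u ≡ false

open Graph public


IsEdge : ∀ {n} → Graph n → Fin n × Fin n → Set
IsEdge G (u , v) = (toℕ u < toℕ v) × (Adj G u v ≡ true)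

edges : ∀ {n} → Graph n → List (Fin n × Fin n)
edges {n} G = filter (λ { (u , v) → (toℕ u <? toℕ v) ×-dec (Adj G u v B.≟ true) })
                     (cartesianProduct (allFin n) (allFin n))

numEdges : ∀ {n} → Graph n → ℕ
numEdges G = length (edges G)

IsEdgeSet : ∀ {n} → Graph n → List (Fin n × Fin n) → Set
IsEdgeSet G R = All (IsEdge G) R × Unique R

incidentIn : ∀ {n} → Fin n → List (Fin n × Fin n) → List (Fin n × Fin n)
incidentIn x R = filter (λ e → (x ≟ proj₁ e) ⊎-dec (x ≟ proj₂ e)) R

IsTwoPacking : ∀ {n} → Graph n → List (Fin n × Fin n) → Set
IsTwoPacking {n} G R = IsEdgeSet G R × (∀ (x : Fin n) → length (incidentIn x R) ≤ 2)

-- maximum 2-packing (its size is ν₂(G))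
IsMaxTwoPacking : ∀ {n} → Graph n → List (Fin n × Fin n) → Set
IsMaxTwoPacking G R = IsTwoPacking G R × (∀ R' → IsTwoPacking G R' → length R' ≤ length R)

-- connectivity of G (via walks along adjacencies); a connected graph is nonempty
AdjRel : ∀ {n} → Graph n → Fin n → Fin n → Set
AdjRel G u v = Adj G u v ≡ true

Connected : ∀ {n} → Graph n → Set
Connected {n} G = Fin n × (∀ (u v : Fin n) → Star (AdjRel G) u v)

-- G[R]: vertices are endpoints of edges in R, edges are those of R
InR : ∀ {n} → List (Fin n × Fin n) → Fin n → Fin n → Set
InR R u v = ((u , v) ∈ R) ⊎ ((v , u) ∈ R)

VertexOf : ∀ {n} → List (Fin n × Fin n) → Fin n → Set
VertexOf R x = Any (λ e → (x ≡ proj₁ e) ⊎ (x ≡ proj₂ e)) R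

InducedConnected : ∀ {n} → List (Fin n × Fin n) → Set
InducedConnected {n} R = ∀ (u v : Fin n) → VertexOf R u → VertexOf R v → Star (InR R) u v

Dominating : ∀ {n} → Graph n → List (Fin n) → Set
Dominating {n} G D = ∀ (v : Fin n) → (v ∈ D) ⊎ Any (λ d → Adj G d v ≡ true) D

{-# OPTIONS --safe #-}
-- Let k = |R| and call a vertex saturated, a leaf or isolated according as it meets 2, 1 or 0 edges
-- of R; counting incidences gives 2·#saturated + #leaves = 2k.  As G[R] is connected and k ≥ 2, no
-- edge of R joins two leaves, so every leaf has a saturated R-neighbour; by maximality of R and
-- connectivity of G, every isolated vertex has a saturated neighbour.  Hence the saturated vertices
-- dominate G, which settles the case of at least three leaves.  With one or two leaves, at most four
-- edges of R meet the R-neighbours of leaves, so some edge gh of R avoids them, and one of g, h can be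
-- dropped: otherwise there are isolated vertices v ~ g and v′ ~ h, not adjacent to h resp. g, and
-- R − gh + vg + v′h is a larger 2-packing.  Without leaves but with an isolated vertex w, exchanging
-- an R-edge at a saturated neighbour a of w for wa yields a maximum 2-packing with a leaf.  Finally,
-- if all vertices are saturated then n = k, and all vertices but some a and some c ∉ N_R[a] dominate.
module Submission where

open import Defs hiding (sym)
open import Data.Bool using (true)
import Data.Bool as Bool
open import Data.Empty using (⊥; ⊥-elim)
open import Data.Fin using (Fin; zero; suc; toℕ; _≟_; fromℕ<)
import Data.Fin.Properties as Fin
open import Data.List using (List; []; _∷_; length; filter; map; allFin; tabulate)
open import Data.List.Properties using (length-removeAt′; length-map)
open import Data.List.Membership.Propositional using (_∈_; lose; find)
open import Data.List.Membership.Propositional.Properties using (∈-filter⁺; ∈-filter⁻; ∈-allFin; ∈-map⁺)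
open import Data.List.Relation.Unary.All as All using (All; []; _∷_)
import Data.List.Relation.Unary.All.Properties as All
open import Data.List.Relation.Unary.AllPairs using (_∷_)
open import Data.List.Relation.Unary.Any as Any using (Any; here; there; _─_)
open import Data.List.Relation.Unary.Unique.Propositional using (Unique)
import Data.Nat as ℕ
open import Data.Nat using (ℕ; zero; suc; _+_; _∸_; _≤_; _<_; z≤n; s≤s; _<?_; _≤?_)
import Data.Nat.ListAction as List
open import Data.Nat.Properties hiding (_≟_)
open import Data.Nat.Tactic.RingSolver using (solve-∀)
open import Algebra.Properties.CommutativeMonoid.Sum +-0-commutativeMonoid using (sum; ∑-distrib-+; sum-cong-≗)
open import Algebra.Properties.CommutativeSemigroup +-commutativeSemigroup using (x∙yz≈y∙xz; interchange)
open import Data.Product using (_×_; _,_; proj₁; proj₂; Σ; ∃; ∃₂)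
open import Data.Sum using (_⊎_; inj₁; inj₂)
open import Data.Unit using (tt)
open import Function using (_∘_)
open import Level using (Level)
open import Relation.Binary using (tri<; tri≈; tri>)
open import Relation.Binary.Construct.Closure.ReflexiveTransitive using (Star; ε; _◅_)
open import Relation.Binary.PropositionalEquality
open import Relation.Nullary using (Dec; yes; no; ¬_; ¬?; contradiction)
open import Relation.Nullary.Decidable using (_⊎-dec_; _×-dec_)
open import Relation.Unary using (Pred; Decidable)
open import Relation.Unary.Properties using (U?)

private
  variable
    p q : Level
    P : Set p
    Q : Set q
    n : ℕ

𝟙 : Dec P → ℕ
𝟙 (yes _) = 1
𝟙 (no _)  = 0

𝟙-yes : (d : Dec P) → P → 𝟙 d ≡ 1
𝟙-yes (yes _) _  = refl
𝟙-yes (no ¬p) p  = contradiction p ¬p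

𝟙-no : (d : Dec P) → ¬ P → 𝟙 d ≡ 0
𝟙-no (yes p) ¬p = contradiction p ¬p
𝟙-no (no _)  _  = refl

𝟙≤1 : (d : Dec P) → 𝟙 d ≤ 1
𝟙≤1 (yes _) = s≤s z≤n
𝟙≤1 (no _)  = z≤n

𝟙-⇔ : (d : Dec P) (e : Dec Q) → (P → Q) → (Q → P) → 𝟙 d ≡ 𝟙 e
𝟙-⇔ (yes _) (yes _) _ _ = refl
𝟙-⇔ (yes p) (no ¬q) f _ = contradiction (f p) ¬q
𝟙-⇔ (no ¬p) (yes q) _ g = contradiction (g q) ¬p
𝟙-⇔ (no _)  (no _)  _ _ = refl

𝟙-⊎ : (d : Dec P) (e : Dec Q) → ¬ (P × Q) → 𝟙 (d ⊎-dec e) ≡ 𝟙 d + 𝟙 e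
𝟙-⊎ (yes p) (yes q) ¬pq = contradiction (p , q) ¬pq
𝟙-⊎ (yes _) (no _)  _   = refl
𝟙-⊎ (no _)  (yes _) _   = refl
𝟙-⊎ (no _)  (no _)  _   = refl

∑-mono-≤ : (f g : Fin n → ℕ) → (∀ x → f x ≤ g x) → sum f ≤ sum g
∑-mono-≤ {zero}  f g f≤g = z≤n
∑-mono-≤ {suc n} f g f≤g = +-mono-≤ (f≤g zero) (∑-mono-≤ (f ∘ suc) (g ∘ suc) (f≤g ∘ suc))

≤-∑ : (f : Fin n → ℕ) (x : Fin n) → f x ≤ sum f
≤-∑ f zero    = m≤m+n (f zero) _
≤-∑ f (suc x) = ≤-trans (≤-∑ (f ∘ suc) x) (m≤n+m _ (f zero))

∑-zero : ∀ n → sum {n} (λ _ → 0) ≡ 0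
∑-zero zero    = refl
∑-zero (suc n) = ∑-zero n

∑-one : ∀ n → sum {n} (λ _ → 1) ≡ n
∑-one zero    = refl
∑-one (suc n) = cong suc (∑-one n)

∑-indicator : (a : Fin n) → sum (λ x → 𝟙 (x ≟ a)) ≡ 1
∑-indicator {suc n} zero    =
  cong suc (trans (sum-cong-≗ {n} (λ x → 𝟙-no (suc x ≟ zero) λ ())) (∑-zero n))
∑-indicator {suc n} (suc a) = trans (sum-cong-≗ 𝟙-suc) (∑-indicator a)
  where
  𝟙-suc : ∀ x → 𝟙 (suc x ≟ suc a) ≡ 𝟙 (x ≟ a)
  𝟙-suc x = 𝟙-⇔ (suc x ≟ suc a) (x ≟ a) Fin.suc-injective (cong suc)

count : {P : Pred (Fin n) p} → Decidable P → ℕ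
count P? = sum (λ x → 𝟙 (P? x))

infixl 5 _-ᵥ_

_-ᵥ_ : {P : Pred (Fin n) p} → Decidable P → (a : Fin n) → Decidable (λ x → P x × x ≢ a)
(P? -ᵥ a) x = P? x ×-dec ¬? (x ≟ a)

module _ {P : Pred (Fin n) p} (P? : Decidable P) where

  count-all : (∀ x → P x) → count P? ≡ n
  count-all all = trans (sum-cong-≗ (λ x → 𝟙-yes (P? x) (all x))) (∑-one n)

  count-none : (∀ x → ¬ P x) → count P? ≡ 0
  count-none none = trans (sum-cong-≗ (λ x → 𝟙-no (P? x) (none x))) (∑-zero n)

  count-pos : ∀ {x} → P x → 1 ≤ count P?
  count-pos {x} px = ≤-trans (≤-reflexive (sym (𝟙-yes (P? x) px))) (≤-∑ (λ y → 𝟙 (P? y)) x)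

  ∑-split : ∀ a → sum (λ x → 𝟙 ((P? -ᵥ a) x) + 𝟙 (x ≟ a)) ≡ suc (count (P? -ᵥ a))
  ∑-split a = begin
    sum (λ x → 𝟙 ((P? -ᵥ a) x) + 𝟙 (x ≟ a))
      ≡⟨ ∑-distrib-+ (λ x → 𝟙 ((P? -ᵥ a) x)) (λ x → 𝟙 (x ≟ a)) ⟩
    count (P? -ᵥ a) + sum (λ x → 𝟙 (x ≟ a))
      ≡⟨ cong (count (P? -ᵥ a) +_) (∑-indicator a) ⟩
    count (P? -ᵥ a) + 1
      ≡⟨ +-comm _ 1 ⟩
    suc (count (P? -ᵥ a)) ∎
    where open ≡-Reasoning

  count-∖ : ∀ {a} → P a → suc (count (P? -ᵥ a)) ≡ count P?
  count-∖ {a} pa = trans (sym (∑-split a)) (sum-cong-≗ split)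
    where
    split : ∀ x → 𝟙 ((P? -ᵥ a) x) + 𝟙 (x ≟ a) ≡ 𝟙 (P? x)
    split x with x ≟ a
    ... | yes refl = trans (cong (_+ 1) (𝟙-no _ (λ (_ , x≢a) → x≢a refl))) (sym (𝟙-yes (P? x) pa))
    ... | no x≢a   = trans (+-identityʳ _) (𝟙-⇔ _ (P? x) proj₁ (_, x≢a))

  count≤1+count-∖ : ∀ a → count P? ≤ suc (count (P? -ᵥ a))
  count≤1+count-∖ a = ≤-trans (∑-mono-≤ _ _ split) (≤-reflexive (∑-split a))
    where
    split : ∀ x → 𝟙 (P? x) ≤ 𝟙 ((P? -ᵥ a) x) + 𝟙 (x ≟ a)
    split x with x ≟ a
    ... | yes refl = ≤-trans (𝟙≤1 (P? x)) (m≤n+m 1 _)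
    ... | no x≢a   = ≤-reflexive (trans (𝟙-⇔ (P? x) _ (_, x≢a) proj₁) (sym (+-identityʳ _)))

count-pos⇒∃ : {P : Pred (Fin n) p} (P? : Decidable P) → 1 ≤ count P? → ∃ P
count-pos⇒∃ {n = zero}  P? ()
count-pos⇒∃ {n = suc n} P? pos with P? zero
... | yes p = zero , p
... | no _  = let (x , px) = count-pos⇒∃ (P? ∘ suc) pos in suc x , px

count-all-but-two : ∀ {a c : Fin n} → c ≢ a → suc (suc (count (U? -ᵥ a -ᵥ c))) ≡ n
count-all-but-two {n} {a} {c} c≢a = begin
  suc (suc (count (U? -ᵥ a -ᵥ c))) ≡⟨ cong suc (count-∖ (U? -ᵥ a) (tt , c≢a)) ⟩
  suc (count (U? -ᵥ a))           ≡⟨ count-∖ (U? {A = Fin n}) {a} tt ⟩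
  count (U? {A = Fin n})          ≡⟨ count-all (U? {A = Fin n}) _ ⟩
  n                               ∎
  where open ≡-Reasoning

∃-avoiding-three : 4 ≤ n → (a b c : Fin n) → ∃ λ x → x ≢ a × x ≢ b × x ≢ c
∃-avoiding-three {n} 4≤n a b c =
  let x , ((_ , x≢a) , x≢b) , x≢c = count-pos⇒∃ (U? -ᵥ a -ᵥ b -ᵥ c) (≤-pred (≤-pred (≤-pred 4≤3+count)))
  in x , x≢a , x≢b , x≢c
  where
  open ≤-Reasoning
  4≤3+count : 4 ≤ suc (suc (suc (count (U? -ᵥ a -ᵥ b -ᵥ c))))
  4≤3+count = begin
    4                                            ≤⟨ 4≤n ⟩
    n                                            ≡⟨ sym (count-all (U? {A = Fin n}) _) ⟩
    count (U? {A = Fin n})                       ≤⟨ count≤1+count-∖ U? a ⟩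
    suc (count (U? -ᵥ a))                        ≤⟨ s≤s (count≤1+count-∖ (U? -ᵥ a) b) ⟩
    suc (suc (count (U? -ᵥ a -ᵥ b)))             ≤⟨ s≤s (s≤s (count≤1+count-∖ (U? -ᵥ a -ᵥ b) c)) ⟩
    suc (suc (suc (count (U? -ᵥ a -ᵥ b -ᵥ c))))  ∎

length-filter-tabulate : ∀ {a} {A : Set a} {P : Pred A p} (P? : Decidable P) (f : Fin n → A) →
                         length (filter P? (tabulate f)) ≡ sum (λ x → 𝟙 (P? (f x)))
length-filter-tabulate {n = zero}  P? f = refl
length-filter-tabulate {n = suc n} P? f with P? (f zero)
... | yes _ = cong suc (length-filter-tabulate P? (f ∘ suc))
... | no _  = length-filter-tabulate P? (f ∘ suc)

length-filter-∷ : ∀ {a} {A : Set a} {P : Pred A p} (P? : Decidable P) x xs →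
                  length (filter P? (x ∷ xs)) ≡ 𝟙 (P? x) + length (filter P? xs)
length-filter-∷ P? x xs with P? x
... | yes _ = refl
... | no _  = refl

vertices : {P : Pred (Fin n) p} → Decidable P → List (Fin n)
vertices {n} P? = filter P? (allFin n)

length-vertices : {P : Pred (Fin n) p} (P? : Decidable P) → length (vertices P?) ≡ count P?
length-vertices P? = length-filter-tabulate P? (λ x → x)

∈-vertices : {P : Pred (Fin n) p} (P? : Decidable P) {x : Fin n} → P x → x ∈ vertices P?
∈-vertices P? {x} = ∈-filter⁺ P? (∈-allFin x)

1+m<n⇒m≤n∸2 : ∀ {m n} → suc m < n → m ≤ n ∸ 2
1+m<n⇒m≤n∸2 {m} {n} 1+m<n = m+n≤o⇒m≤o∸n m (subst (_≤ n) (+-comm 2 m) 1+m<n)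

m+m<n+n⇒m<n : ∀ {m n} → m + m < n + n → m < n
m+m<n+n⇒m<n m+m<n+n = ≰⇒> λ n≤m → <⇒≱ m+m<n+n (+-mono-≤ n≤m n≤m)

m+m≡n+n⇒m≡n : ∀ {m n} → m + m ≡ n + n → m ≡ n
m+m≡n+n⇒m≡n {m} {n} eq with <-cmp m n
... | tri< m<n _ _ = contradiction eq (<⇒≢ (+-mono-< m<n m<n))
... | tri≈ _ m≡n _ = m≡n
... | tri> _ _ n<m = contradiction (sym eq) (<⇒≢ (+-mono-< n<m n<m))

≤2∧≢2⇒≤1 : ∀ {m} → m ≤ 2 → m ≢ 2 → m ≤ 1
≤2∧≢2⇒≤1 m≤2 m≢2 = ≤-pred (≤∧≢⇒< m≤2 m≢2)

half-<-bound : ∀ {a b k} → a + a + b ≡ k + k → 1 ≤ b → a < k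
half-<-bound {a} eq 1≤b = m+m<n+n⇒m<n (subst (a + a <_) eq (m<m+n (a + a) 1≤b))

half-∸2-bound : ∀ {a b k} → a + a + b ≡ k + k → 3 ≤ b → a ≤ k ∸ 2
half-∸2-bound {a} {b} {k} eq 3≤b = 1+m<n⇒m≤n∸2 (m+m<n+n⇒m<n {n = k} (begin-strict
  suc a + suc a     ≡⟨ double-suc a ⟩
  a + a + 2         <⟨ +-monoʳ-< (a + a) 3≤b ⟩
  a + a + b         ≡⟨ eq ⟩
  k + k             ∎))
  where
  open ≤-Reasoning
  double-suc : ∀ a → suc a + suc a ≡ a + a + 2
  double-suc = solve-∀

Incident : Fin n → Fin n × Fin n → Set
Incident x e = (x ≡ proj₁ e) ⊎ (x ≡ proj₂ e)

incident? : (x : Fin n) (e : Fin n × Fin n) → Dec (Incident x e)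
incident? x e = (x ≟ proj₁ e) ⊎-dec (x ≟ proj₂ e)

NonLoop : Fin n × Fin n → Set
NonLoop e = proj₁ e ≢ proj₂ e

other : Fin n → Fin n × Fin n → Fin n
other x (u , v) with x ≟ u
... | yes _ = v
... | no _  = u

module _ {x : Fin n} where

  incident-other : ∀ e → Incident (other x e) e
  incident-other (u , v) with x ≟ u
  ... | yes _ = inj₂ refl
  ... | no _  = inj₁ refl

  other-unique : ∀ {y e} → Incident x e → Incident y e → y ≢ x → y ≡ other x e
  other-unique {y} {u , v} x∈e y∈e y≢x with x ≟ u | x∈e | y∈e
  ... | yes refl | _        | inj₁ refl = contradiction refl y≢x
  ... | yes refl | _        | inj₂ refl = refl
  ... | no x≢u   | inj₁ x≡u | _         = contradiction x≡u x≢u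
  ... | no _     | inj₂ refl | inj₁ refl = refl
  ... | no _     | inj₂ refl | inj₂ refl = contradiction refl y≢x

  other-≢ : ∀ {e} → NonLoop e → Incident x e → other x e ≢ x
  other-≢ {u , v} u≢v x∈e with x ≟ u | x∈e
  ... | yes refl | _         = λ v≡u → u≢v (sym v≡u)
  ... | no x≢u   | inj₁ x≡u  = contradiction x≡u x≢u
  ... | no _     | inj₂ refl = u≢v


other-involutive : ∀ {x : Fin n} {e} → NonLoop e → Incident x e → other (other x e) e ≡ x
other-involutive {e = e} ne x∈e =
  sym (other-unique (incident-other e) x∈e (λ x≡o → other-≢ ne x∈e (sym x≡o)))

edge : Fin n → Fin n → Fin n × Fin n
edge u v with toℕ u <? toℕ v
... | yes _ = u , v
... | no _  = v , u

module _ (u v : Fin n) where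

  incident-edgeˡ : Incident u (edge u v)
  incident-edgeˡ with toℕ u <? toℕ v
  ... | yes _ = inj₁ refl
  ... | no _  = inj₂ refl

  incident-edgeʳ : Incident v (edge u v)
  incident-edgeʳ with toℕ u <? toℕ v
  ... | yes _ = inj₂ refl
  ... | no _  = inj₁ refl

  incident-edge⁻ : ∀ {x} → Incident x (edge u v) → x ≡ u ⊎ x ≡ v
  incident-edge⁻ x∈e with toℕ u <? toℕ v | x∈e
  ... | yes _ | inj₁ x≡u = inj₁ x≡u
  ... | yes _ | inj₂ x≡v = inj₂ x≡v
  ... | no _  | inj₁ x≡v = inj₂ x≡v
  ... | no _  | inj₂ x≡u = inj₁ x≡u

isEdge-≡ : ∀ {G : Graph n} {e f} → IsEdge G e → IsEdge G f →
           Incident (proj₁ f) e → Incident (proj₂ f) e → f ≡ e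
isEdge-≡ _        (f< , _) (inj₁ refl) (inj₁ refl) = contradiction f< (<-irrefl refl)
isEdge-≡ _        _        (inj₁ refl) (inj₂ refl) = refl
isEdge-≡ (e< , _) (f< , _) (inj₂ refl) (inj₁ refl) = contradiction e< (<-asym f<)
isEdge-≡ _        (f< , _) (inj₂ refl) (inj₂ refl) = contradiction f< (<-irrefl refl)

module _ (G : Graph n) where

  adj⇒≢ : ∀ {u v} → Adj G u v ≡ true → u ≢ v
  adj⇒≢ {u} uv refl with () ← trans (sym (Graph.irrefl G u)) uv

  isEdge⇒nonLoop : ∀ {e} → IsEdge G e → NonLoop e
  isEdge⇒nonLoop (_ , uv) = adj⇒≢ uv

  isEdge-edge : ∀ {u v} → Adj G u v ≡ true → IsEdge G (edge u v)
  isEdge-edge {u} {v} uv with toℕ u <? toℕ v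
  ... | yes u<v = u<v , uv
  ... | no u≮v  = v<u , trans (Graph.sym G v u) uv
    where
    v<u : toℕ v < toℕ u
    v<u = ≤∧≢⇒< (≮⇒≥ u≮v) (λ eq → adj⇒≢ uv (sym (Fin.toℕ-injective eq)))

  adj-other : ∀ {x e} → IsEdge G e → Incident x e → Adj G (other x e) x ≡ true
  adj-other {x} {u , v} (_ , uv) x∈e with x ≟ u | x∈e
  ... | yes refl | _        = trans (Graph.sym G v x) uv
  ... | no x≢u   | inj₁ x≡u = contradiction x≡u x≢u
  ... | no _     | inj₂ refl = uv

deg : List (Fin n × Fin n) → Fin n → ℕ
deg R x = length (incidentIn x R)

module _ {x : Fin n} where

  deg-∷ : ∀ e L → deg (e ∷ L) x ≡ 𝟙 (incident? x e) + deg L x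
  deg-∷ = length-filter-∷ (incident? x)

  deg-─ : ∀ {e R} (e∈R : e ∈ R) → deg R x ≡ 𝟙 (incident? x e) + deg (R ─ e∈R) x
  deg-─ {R = e ∷ R} (here refl) = deg-∷ e R
  deg-─ {e} {f ∷ R} (there e∈R) = begin
    deg (f ∷ R) x
      ≡⟨ deg-∷ f R ⟩
    𝟙 (incident? x f) + deg R x
      ≡⟨ cong (𝟙 (incident? x f) +_) (deg-─ e∈R) ⟩
    𝟙 (incident? x f) + (𝟙 (incident? x e) + deg (R ─ e∈R) x)
      ≡⟨ x∙yz≈y∙xz (𝟙 (incident? x f)) (𝟙 (incident? x e)) _ ⟩
    𝟙 (incident? x e) + (𝟙 (incident? x f) + deg (R ─ e∈R) x)
      ≡⟨ cong (𝟙 (incident? x e) +_) (sym (deg-∷ f (R ─ e∈R))) ⟩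
    𝟙 (incident? x e) + deg (f ∷ (R ─ e∈R)) x ∎
    where open ≡-Reasoning

  ∈-incidentIn : ∀ {e R} → e ∈ R → Incident x e → e ∈ incidentIn x R
  ∈-incidentIn = ∈-filter⁺ (incident? x)

  ∈-incidentIn⁻ : ∀ {e} R → e ∈ incidentIn x R → e ∈ R × Incident x e
  ∈-incidentIn⁻ R = ∈-filter⁻ (incident? x) {xs = R}

  deg-pos : ∀ {e R} → e ∈ R → Incident x e → 1 ≤ deg R x
  deg-pos e∈R x∈e = nonempty (∈-incidentIn e∈R x∈e)
    where
    nonempty : ∀ {A : Set} {y : A} {ys} → y ∈ ys → 1 ≤ length ys
    nonempty (here _)  = s≤s z≤n
    nonempty (there _) = s≤s z≤n

  deg≡0⇒¬incident : ∀ {e R} → deg R x ≡ 0 → e ∈ R → ¬ Incident x e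
  deg≡0⇒¬incident d≡0 e∈R x∈e = contradiction (subst (1 ≤_) d≡0 (deg-pos e∈R x∈e)) λ ()

  deg≡1⇒unique : ∀ {e f R} → deg R x ≡ 1 → e ∈ R → f ∈ R → Incident x e → Incident x f → e ≡ f
  deg≡1⇒unique {e} {f} {R} d≡1 e∈R f∈R x∈e x∈f =
    single (incidentIn x R) d≡1 (∈-incidentIn e∈R x∈e) (∈-incidentIn f∈R x∈f)
    where
    single : ∀ ys → length ys ≡ 1 → e ∈ ys → f ∈ ys → e ≡ f
    single (_ ∷ []) _ (here refl) (here refl) = refl

  deg-pos⇒incident : ∀ {R} → 1 ≤ deg R x → ∃ λ e → e ∈ R × Incident x e
  deg-pos⇒incident {R} pos with incidentIn x R in eq
  ... | e ∷ _ = e , ∈-incidentIn⁻ R (subst (e ∈_) (sym eq) (here refl))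
  ... | []    = contradiction pos λ ()

  deg≡2⇒two-edges : ∀ {R} → deg R x ≡ 2 → ∃₂ λ f₁ f₂ → incidentIn x R ≡ f₁ ∷ f₂ ∷ []
  deg≡2⇒two-edges {R} saturated with incidentIn x R
  ... | f₁ ∷ f₂ ∷ [] = f₁ , f₂ , refl

∑-incident : ∀ {e : Fin n × Fin n} → NonLoop e → sum (λ x → 𝟙 (incident? x e)) ≡ 2
∑-incident {e = u , v} u≢v = begin
  sum (λ x → 𝟙 (incident? x (u , v)))
    ≡⟨ sum-cong-≗ (λ x → 𝟙-⊎ (x ≟ u) (x ≟ v) λ (x≡u , x≡v) → u≢v (trans (sym x≡u) x≡v)) ⟩
  sum (λ x → 𝟙 (x ≟ u) + 𝟙 (x ≟ v))
    ≡⟨ ∑-distrib-+ (λ x → 𝟙 (x ≟ u)) (λ x → 𝟙 (x ≟ v)) ⟩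
  sum (λ x → 𝟙 (x ≟ u)) + sum (λ x → 𝟙 (x ≟ v))
    ≡⟨ cong₂ _+_ (∑-indicator u) (∑-indicator v) ⟩
  2 ∎
  where open ≡-Reasoning

handshake : ∀ (R : List (Fin n × Fin n)) → All NonLoop R → sum (deg R) ≡ length R + length R
handshake {n} [] [] = ∑-zero n
handshake {n} (e ∷ R) (ne ∷ nes) = begin
  sum (deg (e ∷ R))                                 ≡⟨ sum-cong-≗ (λ x → deg-∷ {x = x} e R) ⟩
  sum (λ x → 𝟙 (incident? x e) + deg R x)           ≡⟨ ∑-distrib-+ (λ x → 𝟙 (incident? x e)) (deg R) ⟩
  sum (λ x → 𝟙 (incident? x e)) + sum (deg R)       ≡⟨ cong₂ _+_ (∑-incident {n} ne) (handshake R nes) ⟩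
  2 + (length R + length R)                         ≡⟨ cong suc (sym (+-suc (length R) (length R))) ⟩
  length (e ∷ R) + length (e ∷ R)                   ∎
  where open ≡-Reasoning

deg≟ : (R : List (Fin n × Fin n)) (k : ℕ) → Decidable (λ x → deg R x ≡ k)
deg≟ R k x = deg R x ℕ.≟ k

degree-count : (R : List (Fin n × Fin n)) → All NonLoop R → (∀ x → deg R x ≤ 2) →
               count (deg≟ R 2) + count (deg≟ R 2) + count (deg≟ R 1) ≡ length R + length R
degree-count R nonLoop deg≤2 = begin
  count (deg≟ R 2) + count (deg≟ R 2) + count (deg≟ R 1)
    ≡⟨ cong (_+ count (deg≟ R 1)) (sym (∑-distrib-+ (λ x → 𝟙 (deg≟ R 2 x)) _)) ⟩
  sum (λ x → 𝟙 (deg≟ R 2 x) + 𝟙 (deg≟ R 2 x)) + count (deg≟ R 1)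
    ≡⟨ sym (∑-distrib-+ (λ x → 𝟙 (deg≟ R 2 x) + 𝟙 (deg≟ R 2 x)) (λ x → 𝟙 (deg≟ R 1 x))) ⟩
  sum (λ x → 𝟙 (deg≟ R 2 x) + 𝟙 (deg≟ R 2 x) + 𝟙 (deg≟ R 1 x))
    ≡⟨ sum-cong-≗ (λ x → sym (by-value (deg R x) (deg≤2 x))) ⟩
  sum (deg R)
    ≡⟨ handshake R nonLoop ⟩
  length R + length R ∎
  where
  open ≡-Reasoning
  by-value : ∀ d → d ≤ 2 → d ≡ 𝟙 (d ℕ.≟ 2) + 𝟙 (d ℕ.≟ 2) + 𝟙 (d ℕ.≟ 1)
  by-value 0 _ = refl
  by-value 1 _ = refl
  by-value 2 _ = refl
  by-value (suc (suc (suc _))) (s≤s (s≤s ()))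

module _ {a} {A : Set a} {P : Pred A p} where

  unique-─ : ∀ {xs} (p : Any P xs) → Unique xs → Unique (xs ─ p)
  unique-─ (here _)  (_ ∷ u)    = u
  unique-─ (there p) (x≢ ∷ u)  = All.─⁺ p x≢ ∷ unique-─ p u

  ∈-─⁻ : ∀ {xs y} (p : Any P xs) → y ∈ (xs ─ p) → y ∈ xs
  ∈-─⁻ (here _)  y∈       = there y∈
  ∈-─⁻ (there p) (here eq) = here eq
  ∈-─⁻ (there p) (there y∈) = there (∈-─⁻ p y∈)

module _ {x : Fin n} {e : Fin n × Fin n} {R : List (Fin n × Fin n)} (e∈R : e ∈ R) where

  deg-─-≤ : deg (R ─ e∈R) x ≤ deg R x
  deg-─-≤ = subst (deg (R ─ e∈R) x ≤_) (sym (deg-─ e∈R)) (m≤n+m _ _)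

  deg-─-incident : Incident x e → suc (deg (R ─ e∈R) x) ≡ deg R x
  deg-─-incident x∈e = trans (cong (_+ deg (R ─ e∈R) x) (sym (𝟙-yes (incident? x e) x∈e))) (sym (deg-─ e∈R))

  deg-─-¬incident : ¬ Incident x e → deg (R ─ e∈R) x ≡ deg R x
  deg-─-¬incident x∉e = sym (trans (deg-─ e∈R) (cong (_+ deg (R ─ e∈R) x) (𝟙-no (incident? x e) x∉e)))

  deg-─-free : deg R x ≡ 0 → deg (R ─ e∈R) x ≡ 0
  deg-─-free free = n≤0⇒n≡0 (subst (deg (R ─ e∈R) x ≤_) free deg-─-≤)

  deg-─-incident-≤1 : deg R x ≤ 2 → Incident x e → deg (R ─ e∈R) x ≤ 1
  deg-─-incident-≤1 deg≤2 x∈e = ≤-pred (subst (_≤ 2) (sym (deg-─-incident x∈e)) deg≤2)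

deg-∷-¬incident : ∀ {x : Fin n} {e} L → ¬ Incident x e → deg (e ∷ L) x ≡ deg L x
deg-∷-¬incident {x = x} {e} L x∉e = trans (deg-∷ e L) (cong (_+ deg L x) (𝟙-no (incident? x e) x∉e))

free≢incident : ∀ {v w : Fin n} {e R} → deg R v ≡ 0 → e ∈ R → Incident w e → v ≢ w
free≢incident free e∈R w∈e refl = deg≡0⇒¬incident free e∈R w∈e

module _ (G : Graph n) where

  ─-isTwoPacking : ∀ {R e} → IsTwoPacking G R → (e∈R : e ∈ R) → IsTwoPacking G (R ─ e∈R)
  ─-isTwoPacking ((edges , unique) , deg≤2) e∈R =
    (All.─⁺ e∈R edges , unique-─ e∈R unique) , λ x → ≤-trans (deg-─-≤ e∈R) (deg≤2 x)

  ∷-isTwoPacking : ∀ {L w u} → IsTwoPacking G L → deg L w ≡ 0 → deg L u ≤ 1 → Adj G w u ≡ true →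
                   IsTwoPacking G (edge w u ∷ L)
  ∷-isTwoPacking {L} {w} {u} ((edges , unique) , deg≤2) w-free u≤1 wu =
    (isEdge-edge G wu ∷ edges , fresh ∷ unique) , deg≤2′
    where
    fresh : All (edge w u ≢_) L
    fresh = All.tabulate λ f∈L wu≡f →
      deg≡0⇒¬incident w-free f∈L (subst (Incident w) wu≡f (incident-edgeˡ w u))
    deg≤2′ : ∀ x → deg (edge w u ∷ L) x ≤ 2
    deg≤2′ x = subst (_≤ 2) (sym (deg-∷ (edge w u) L)) (by-incidence (incident? x (edge w u)))
      where
      by-incidence : (d : Dec (Incident x (edge w u))) → 𝟙 d + deg L x ≤ 2
      by-incidence (no _)     = deg≤2 x
      by-incidence (yes x∈wu) with incident-edge⁻ w u x∈wu
      ... | inj₁ refl = s≤s (≤-trans (≤-reflexive w-free) z≤n)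
      ... | inj₂ refl = s≤s u≤1

  swap-isTwoPacking : ∀ {R e w a} → IsTwoPacking G R → (e∈R : e ∈ R) → Incident a e →
                      deg R w ≡ 0 → Adj G w a ≡ true → IsTwoPacking G (edge w a ∷ (R ─ e∈R))
  swap-isTwoPacking {a = a} packing e∈R a∈e w-free wa =
    ∷-isTwoPacking (─-isTwoPacking packing e∈R) (deg-─-free e∈R w-free)
                   (deg-─-incident-≤1 e∈R (proj₂ packing a) a∈e) wa

  isolated-has-neighbour : Connected G → ∀ {R e v} → e ∈ R → deg R v ≡ 0 → ∃ λ u → Adj G v u ≡ true
  isolated-has-neighbour (_ , walk) {e = e} {v} e∈R free with walk v (proj₁ e)
  ... | ε          = contradiction (inj₁ refl) (deg≡0⇒¬incident free e∈R)
  ... | vu ◅ _     = _ , vu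

module Maximum {G : Graph n} {R} (maximum : IsMaxTwoPacking G R) where

  packing : IsTwoPacking G R
  packing = proj₁ maximum

  no-larger : ∀ {L} → IsTwoPacking G L → length L ≡ suc (length R) → ⊥
  no-larger L-packing L≡1+R = <-irrefl refl (subst (_≤ length R) L≡1+R (proj₂ maximum _ L-packing))

  isolated-adj⇒saturated : ∀ {v u} → deg R v ≡ 0 → Adj G v u ≡ true → deg R u ≡ 2
  isolated-adj⇒saturated {v} {u} free vu with deg R u ℕ.≟ 2
  ... | yes u-saturated = u-saturated
  ... | no ¬saturated   =
    ⊥-elim (no-larger (∷-isTwoPacking G packing free (≤2∧≢2⇒≤1 (proj₂ packing u) ¬saturated) vu) refl)

  swap-isMax : ∀ {e w a} (e∈R : e ∈ R) → Incident a e → deg R w ≡ 0 → Adj G w a ≡ true →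
               IsMaxTwoPacking G (edge w a ∷ (R ─ e∈R))
  swap-isMax e∈R a∈e w-free wa =
    swap-isTwoPacking G packing e∈R a∈e w-free wa ,
    λ L L-packing → subst (length L ≤_) (length-removeAt′ R (Any.index e∈R)) (proj₂ maximum L L-packing)

  no-double-swap : ∀ {e g h v v′} (e∈R : e ∈ R) → Incident g e → Incident h e → g ≢ h →
                   deg R v ≡ 0 → deg R v′ ≡ 0 → v ≢ v′ → Adj G v g ≡ true → Adj G v′ h ≡ true → ⊥
  no-double-swap {e} {g} {h} {v} {v′} e∈R g∈e h∈e g≢h v-free v′-free v≢v′ vg v′h =
    no-larger (∷-isTwoPacking G (swap-isTwoPacking G packing e∈R g∈e v-free vg) v′-free₁ h≤1 v′h)
              (cong suc (sym (length-removeAt′ R (Any.index e∈R))))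
    where
    R₀ = R ─ e∈R
    v′∉vg : ¬ Incident v′ (edge v g)
    v′∉vg v′∈vg with incident-edge⁻ v g v′∈vg
    ... | inj₁ v′≡v = v≢v′ (sym v′≡v)
    ... | inj₂ v′≡g = free≢incident v′-free e∈R g∈e v′≡g
    h∉vg : ¬ Incident h (edge v g)
    h∉vg h∈vg with incident-edge⁻ v g h∈vg
    ... | inj₁ h≡v = free≢incident v-free e∈R h∈e (sym h≡v)
    ... | inj₂ h≡g = g≢h (sym h≡g)
    v′-free₁ : deg (edge v g ∷ R₀) v′ ≡ 0
    v′-free₁ = trans (deg-∷-¬incident R₀ v′∉vg) (deg-─-free e∈R v′-free)
    h≤1 : deg (edge v g ∷ R₀) h ≤ 1
    h≤1 = subst (_≤ 1) (sym (deg-∷-¬incident R₀ h∉vg)) (deg-─-incident-≤1 e∈R (proj₂ packing h) h∈e)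

NoK₂Component : List (Fin n × Fin n) → Set
NoK₂Component R = ∀ {e} → e ∈ R → deg R (proj₁ e) ≡ 1 → deg R (proj₂ e) ≡ 1 → ⊥

two-distinct : ∀ {a} {A : Set a} {xs : List A} → Unique xs → 2 ≤ length xs →
               ∃₂ λ x y → x ∈ xs × y ∈ xs × x ≢ y
two-distinct {xs = x ∷ y ∷ _} ((x≢y ∷ _) ∷ _) _            = x , y , here refl , there (here refl) , x≢y
two-distinct {xs = _ ∷ []}    _                 (s≤s ())

module _ {G : Graph n} {R} (packing : IsTwoPacking G R) where

  private
    isEdge : ∀ {e} → e ∈ R → IsEdge G e
    isEdge = All.lookup (proj₁ (proj₁ packing))

  endpoint-off⊎≡ : ∀ {e f} → e ∈ R → f ∈ R → (∃ λ z → Incident z f × ¬ Incident z e) ⊎ f ≡ e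
  endpoint-off⊎≡ {e} {f} e∈R f∈R with incident? (proj₁ f) e | incident? (proj₂ f) e
  ... | no f₁∉e  | _         = inj₁ (proj₁ f , inj₁ refl , f₁∉e)
  ... | yes _    | no f₂∉e   = inj₁ (proj₂ f , inj₂ refl , f₂∉e)
  ... | yes f₁∈e | yes f₂∈e  = inj₂ (isEdge-≡ {G = G} (isEdge e∈R) (isEdge f∈R) f₁∈e f₂∈e)

  vertex-off : ∀ {e} → 2 ≤ length R → e ∈ R → ∃ λ z → VertexOf R z × ¬ Incident z e
  vertex-off {e} 2≤R e∈R with two-distinct {xs = R} (proj₂ (proj₁ packing)) 2≤R
  ... | f , f′ , f∈R , f′∈R , f≢f′ with endpoint-off⊎≡ e∈R f∈R | endpoint-off⊎≡ e∈R f′∈R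
  ...   | inj₁ (z , z∈f , z∉e) | _                      = z , lose f∈R z∈f , z∉e
  ...   | inj₂ _              | inj₁ (z , z∈f′ , z∉e) = z , lose f′∈R z∈f′ , z∉e
  ...   | inj₂ f≡e            | inj₂ f′≡e             = contradiction (trans f≡e (sym f′≡e)) f≢f′

  K₂-closed : ∀ {e s t} → e ∈ R → deg R (proj₁ e) ≡ 1 → deg R (proj₂ e) ≡ 1 →
              Star (InR R) s t → Incident s e → Incident t e
  K₂-closed e∈R deg₁≡1 deg₂≡1 ε s∈e = s∈e
  K₂-closed {e} e∈R deg₁≡1 deg₂≡1 (s→ ◅ walk) s∈e =
    K₂-closed e∈R deg₁≡1 deg₂≡1 walk (step s→ s∈e)
    where
    deg≡1 : ∀ {s} → Incident s e → deg R s ≡ 1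
    deg≡1 (inj₁ refl) = deg₁≡1
    deg≡1 (inj₂ refl) = deg₂≡1
    step : ∀ {s t} → InR R s t → Incident s e → Incident t e
    step (inj₁ st∈R) s∈e = inj₂ (cong proj₂ (deg≡1⇒unique (deg≡1 s∈e) st∈R e∈R (inj₁ refl) s∈e))
    step (inj₂ ts∈R) s∈e = inj₁ (cong proj₁ (deg≡1⇒unique (deg≡1 s∈e) ts∈R e∈R (inj₂ refl) s∈e))

  inducedConnected⇒noK₂Component : 2 ≤ length R → InducedConnected R → NoK₂Component R
  inducedConnected⇒noK₂Component 2≤R connected {e} e∈R deg₁≡1 deg₂≡1 =
    let z , z∈R , z∉e = vertex-off 2≤R e∈R
    in z∉e (K₂-closed e∈R deg₁≡1 deg₂≡1 (connected _ z (lose e∈R (inj₁ refl)) z∈R) (inj₁ refl))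

γ≤ : Graph n → ℕ → Set
γ≤ {n} G k = Σ (List (Fin n)) λ D → Dominating G D × length D ≤ k

vertices-γ≤ : ∀ {G : Graph n} {k} {P : Pred (Fin n) p} (P? : Decidable P) →
              Dominating G (vertices P?) → count P? ≤ k → γ≤ G k
vertices-γ≤ {k = k} P? dominating bound =
  vertices P? , dominating , subst (_≤ k) (sym (length-vertices P?)) bound

module _ (G : Graph n) where

  DominatedBy : List (Fin n) → Fin n → Set
  DominatedBy D v = (v ∈ D) ⊎ Any (λ d → Adj G d v ≡ true) D

  dominatedBy? : ∀ D v → Dec (DominatedBy D v)
  dominatedBy? D v = (v ∈? D) ⊎-dec Any.any? (λ d → Adj G d v Bool.≟ true) D
    where open import Data.List.Membership.DecPropositional _≟_ using (_∈?_)

  dominating⊎undominated : ∀ D → Dominating G D ⊎ ∃ λ v → ¬ DominatedBy D v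
  dominating⊎undominated D with Fin.all? (dominatedBy? D)
  ... | yes dominating  = inj₁ dominating
  ... | no ¬dominating = inj₂ (Fin.¬∀⟶∃¬ n _ (dominatedBy? D) ¬dominating)

  all-but-two-dominating : ∀ {a c p q} → Adj G p a ≡ true → p ≢ c → Adj G q c ≡ true → q ≢ a →
                           Dominating G (vertices (U? -ᵥ a -ᵥ c))
  all-but-two-dominating {a} {c} {p} {q} pa p≢c qc q≢a v with v ≟ a | v ≟ c
  ... | yes refl | _        = inj₂ (lose (∈-vertices (U? -ᵥ a -ᵥ c) ((tt , adj⇒≢ G pa) , p≢c)) pa)
  ... | no _     | yes refl = inj₂ (lose (∈-vertices (U? -ᵥ a -ᵥ c) ((tt , q≢a) , adj⇒≢ G qc)) qc)
  ... | no v≢a   | no v≢c   = inj₁ (∈-vertices (U? -ᵥ a -ᵥ c) ((tt , v≢a) , v≢c))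

∑-deg≤length+length : ∀ {R : List (Fin n × Fin n)} → (∀ x → deg R x ≤ 2) → (ps : List (Fin n)) →
                      List.sum (map (deg R) ps) ≤ length ps + length ps
∑-deg≤length+length deg≤2 []       = z≤n
∑-deg≤length+length {R = R} deg≤2 (p ∷ ps) =
  subst (List.sum (map (deg R) (p ∷ ps)) ≤_) (cong suc (sym (+-suc (length ps) (length ps))))
        (+-mono-≤ (deg≤2 p) (∑-deg≤length+length {R = R} deg≤2 ps))

length≤∑deg-cover : ∀ (ps : List (Fin n)) L → All (λ e → Any (λ p → Incident p e) ps) L →
                    length L ≤ List.sum (map (deg L) ps)
length≤∑deg-cover ps []      []                = z≤n
length≤∑deg-cover ps (e ∷ L) (covered ∷ cover) = begin
  suc (length L)
    ≤⟨ +-mono-≤ (hit ps covered) (length≤∑deg-cover ps L cover) ⟩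
  List.sum (map (λ p → 𝟙 (incident? p e)) ps) + List.sum (map (deg L) ps)
    ≡⟨ sym (∑-∷ ps) ⟩
  List.sum (map (deg (e ∷ L)) ps) ∎
  where
  open ≤-Reasoning
  hit : ∀ qs → Any (λ p → Incident p e) qs → 1 ≤ List.sum (map (λ p → 𝟙 (incident? p e)) qs)
  hit (q ∷ qs) (here q∈e)  = ≤-trans (≤-reflexive (sym (𝟙-yes (incident? q e) q∈e))) (m≤m+n _ _)
  hit (q ∷ qs) (there any) = ≤-trans (hit qs any) (m≤n+m _ _)
  ∑-∷ : ∀ qs → List.sum (map (deg (e ∷ L)) qs) ≡
               List.sum (map (λ p → 𝟙 (incident? p e)) qs) + List.sum (map (deg L) qs)
  ∑-∷ []       = refl
  ∑-∷ (q ∷ qs) =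
    trans (cong₂ _+_ (deg-∷ {x = q} e L) (∑-∷ qs)) (interchange (𝟙 (incident? q e)) (deg L q) _ _)

module SaturatedDomination {G : Graph n} {R} (connected : Connected G) (maximum : IsMaxTwoPacking G R)
                           (noK₂ : NoK₂Component R) {e₀} (e₀∈R : e₀ ∈ R) where

  open Maximum {G = G} maximum

  private
    isEdge : ∀ {e} → e ∈ R → IsEdge G e
    isEdge = All.lookup (proj₁ (proj₁ packing))

    deg≤2 : ∀ x → deg R x ≤ 2
    deg≤2 = proj₂ packing

  Saturated : List (Fin n)
  Saturated = vertices (deg≟ R 2)

  count-identity : count (deg≟ R 2) + count (deg≟ R 2) + count (deg≟ R 1) ≡ length R + length R
  count-identity = degree-count R (All.map (isEdge⇒nonLoop G) (proj₁ (proj₁ packing))) deg≤2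

  data Kind (v : Fin n) : Set where
    saturated : deg R v ≡ 2 → Kind v
    leaf      : ∀ {e} → e ∈ R → Incident v e → deg R v ≡ 1 → Kind v
    isolated  : deg R v ≡ 0 → Kind v

  kind : ∀ v → Kind v
  kind v with incidentIn v R in eq
  ... | []            = isolated (cong length eq)
  ... | e ∷ []        = let e∈R , v∈e = ∈-incidentIn⁻ R (subst (e ∈_) (sym eq) (here refl))
                        in leaf e∈R v∈e (cong length eq)
  ... | _ ∷ _ ∷ []    = saturated (cong length eq)
  ... | _ ∷ _ ∷ _ ∷ _ = contradiction (subst (_≤ 2) (cong length eq) (deg≤2 v)) λ { (s≤s (s≤s ())) }

  leaf-partner-saturated : ∀ {v e} → e ∈ R → Incident v e → deg R v ≡ 1 → deg R (other v e) ≡ 2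
  leaf-partner-saturated {v} {e} e∈R v∈e v-leaf with deg R (other v e) ℕ.≟ 2
  ... | yes partner-saturated = partner-saturated
  ... | no ¬saturated = ⊥-elim (noK₂ e∈R (endpoint-leaf (inj₁ refl)) (endpoint-leaf (inj₂ refl)))
    where
    partner-leaf : deg R (other v e) ≡ 1
    partner-leaf = ≤-antisym (≤2∧≢2⇒≤1 (deg≤2 _) ¬saturated) (deg-pos e∈R (incident-other e))
    endpoint-leaf : ∀ {y} → Incident y e → deg R y ≡ 1
    endpoint-leaf {y} y∈e with y ≟ v
    ... | yes refl = v-leaf
    ... | no y≢v   = subst (λ z → deg R z ≡ 1) (sym (other-unique v∈e y∈e y≢v)) partner-leaf

  isolated-saturated-neighbour : ∀ {v} → deg R v ≡ 0 → ∃ λ u → Adj G u v ≡ true × deg R u ≡ 2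
  isolated-saturated-neighbour {v} free =
    let u , vu = isolated-has-neighbour G connected e₀∈R free
    in u , trans (Graph.sym G u v) vu , isolated-adj⇒saturated free vu

  saturated-dominating : Dominating G Saturated
  saturated-dominating v with kind v
  ... | saturated v-sat       = inj₁ (∈-vertices (deg≟ R 2) v-sat)
  ... | leaf e∈R v∈e v-leaf   = inj₂ (lose (∈-vertices (deg≟ R 2) (leaf-partner-saturated e∈R v∈e v-leaf))
                                           (adj-other G (isEdge e∈R) v∈e))
  ... | isolated free         = let u , uv , u-sat = isolated-saturated-neighbour free
                                in inj₂ (lose (∈-vertices (deg≟ R 2) u-sat) uv)

  dominated-via : ∀ {g u v} → deg R u ≡ 2 → u ≢ g → Adj G u v ≡ true →
                  DominatedBy G (vertices (deg≟ R 2 -ᵥ g)) v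
  dominated-via u-sat u≢g uv = inj₂ (lose (∈-vertices (deg≟ R 2 -ᵥ _) (u-sat , u≢g)) uv)

  partner : Fin n → Fin n
  partner y = first-other (incidentIn y R)
    where
    first-other : List (Fin n × Fin n) → Fin n
    first-other []      = y
    first-other (f ∷ _) = other y f

  partner-≡ : ∀ {y f} → deg R y ≡ 1 → f ∈ R → Incident y f → partner y ≡ other y f
  partner-≡ {y} {f} y-leaf f∈R y∈f with incidentIn y R | ∈-incidentIn {x = y} f∈R y∈f | y-leaf
  ... | _ ∷ [] | here refl | _ = refl

  Partners : List (Fin n)
  Partners = map partner (vertices (deg≟ R 1))

  NearLeaf : Fin n × Fin n → Set
  NearLeaf e = Any (λ p → Incident p e) Partners

  near-leaf : ∀ {y f e} → deg R y ≡ 1 → f ∈ R → Incident y f → Incident (other y f) e → NearLeaf e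
  near-leaf {y} y-leaf f∈R y∈f o∈e =
    lose (∈-map⁺ partner (∈-vertices (deg≟ R 1) y-leaf))
         (subst (λ p → Incident p _) (sym (partner-≡ y-leaf f∈R y∈f)) o∈e)

  far-edge : 5 ≤ length R → count (deg≟ R 1) ≤ 2 → ∃ λ e → e ∈ R × ¬ NearLeaf e
  far-edge 5≤R leaves≤2 with All.all? (λ e → Any.any? (λ p → incident? p e) Partners) R
  ... | no ¬all-near = find (All.¬All⇒Any¬ (λ e → Any.any? (λ p → incident? p e) Partners) R ¬all-near)
  ... | yes all-near = contradiction 5≤R (<⇒≱ (s≤s (begin
    length R                                           ≤⟨ length≤∑deg-cover Partners R all-near ⟩
    List.sum (map (deg R) Partners)                    ≤⟨ ∑-deg≤length+length {R = R} deg≤2 Partners ⟩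
    length Partners + length Partners                  ≡⟨ cong (λ m → m + m) ∣Partners∣ ⟩
    count (deg≟ R 1) + count (deg≟ R 1)                ≤⟨ +-mono-≤ leaves≤2 leaves≤2 ⟩
    4                                                  ∎)))
    where
    open ≤-Reasoning
    ∣Partners∣ : length Partners ≡ count (deg≟ R 1)
    ∣Partners∣ = trans (length-map partner (vertices (deg≟ R 1))) (length-vertices (deg≟ R 1))

  module FarEdge {e} (e∈R : e ∈ R) (far : ¬ NearLeaf e) where

    endpoint-saturated : ∀ {y} → Incident y e → deg R y ≡ 2
    endpoint-saturated {y} y∈e with kind y
    ... | saturated y-sat = y-sat
    ... | leaf _ _ y-leaf = contradiction (near-leaf y-leaf e∈R y∈e (incident-other e)) far
    ... | isolated free   = contradiction y∈e (deg≡0⇒¬incident free e∈R)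

    neighbour-saturated : ∀ {y f} → Incident y e → f ∈ R → Incident y f → deg R (other y f) ≡ 2
    neighbour-saturated {y} {f} y∈e f∈R y∈f with kind (other y f)
    ... | saturated z-sat = z-sat
    ... | leaf _ _ z-leaf = contradiction (near-leaf z-leaf f∈R (incident-other f) back) far
      where
      back : Incident (other (other y f) f) e
      back = subst (λ w → Incident w e) (sym (other-involutive (isEdge⇒nonLoop G (isEdge f∈R)) y∈f)) y∈e
    ... | isolated free   = contradiction (incident-other f) (deg≡0⇒¬incident free f∈R)

    other-endpoint-adj : ∀ {g h} → Incident g e → Incident h e → h ≢ g → Adj G h g ≡ true
    other-endpoint-adj g∈e h∈e h≢g =
      subst (λ w → Adj G w _ ≡ true) (sym (other-unique g∈e h∈e h≢g)) (adj-other G (isEdge e∈R) g∈e)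

    undominated-isolated : ∀ {g h v} → Incident g e → Incident h e → h ≢ g →
                           ¬ DominatedBy G (vertices (deg≟ R 2 -ᵥ g)) v →
                           deg R v ≡ 0 × Adj G v g ≡ true × ¬ Adj G v h ≡ true
    undominated-isolated {g} {h} {v} g∈e h∈e h≢g ¬dominated with kind v
    ... | saturated v-sat with v ≟ g
    ...   | yes refl =
      ⊥-elim (¬dominated (dominated-via (endpoint-saturated h∈e) h≢g (other-endpoint-adj g∈e h∈e h≢g)))
    ...   | no v≢g   = ⊥-elim (¬dominated (inj₁ (∈-vertices (deg≟ R 2 -ᵥ g) (v-sat , v≢g))))
    undominated-isolated {g} {h} {v} g∈e h∈e h≢g ¬dominated | leaf {f} f∈R v∈f v-leaf with other v f ≟ g
    ...   | yes u≡g = contradiction (trans (sym v-sat) v-leaf) λ ()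
      where
      v≡other-g : v ≡ other g f
      v≡other-g = trans (sym (other-involutive (isEdge⇒nonLoop G (isEdge f∈R)) v∈f)) (cong (λ w → other w f) u≡g)
      v-sat : deg R v ≡ 2
      v-sat = subst (λ w → deg R w ≡ 2) (sym v≡other-g)
                    (neighbour-saturated g∈e f∈R (subst (λ w → Incident w f) u≡g (incident-other f)))
    ...   | no u≢g  =
      ⊥-elim (¬dominated (dominated-via (leaf-partner-saturated f∈R v∈f v-leaf) u≢g (adj-other G (isEdge f∈R) v∈f)))
    undominated-isolated {g} {h} {v} g∈e h∈e h≢g ¬dominated | isolated free with isolated-saturated-neighbour free
    ...   | u , uv , u-sat with u ≟ g
    ...     | no u≢g   = ⊥-elim (¬dominated (dominated-via u-sat u≢g uv))
    ...     | yes refl =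
      free , trans (Graph.sym G v u) uv ,
      λ vh → ¬dominated (dominated-via (endpoint-saturated h∈e) h≢g (trans (Graph.sym G h v) vh))

    removable-endpoint : ∃ λ g → Incident g e × Dominating G (vertices (deg≟ R 2 -ᵥ g))
    removable-endpoint with dominating⊎undominated G (vertices (deg≟ R 2 -ᵥ proj₁ e))
                          | dominating⊎undominated G (vertices (deg≟ R 2 -ᵥ proj₂ e))
    ... | inj₁ dominating | _               = proj₁ e , inj₁ refl , dominating
    ... | inj₂ _          | inj₁ dominating = proj₂ e , inj₂ refl , dominating
    ... | inj₂ (v , ¬v)   | inj₂ (v′ , ¬v′) =
      let v-free  , vg  , ¬vh  = undominated-isolated (inj₁ refl) (inj₂ refl) (λ h≡g → g≢h (sym h≡g)) ¬v
          v′-free , v′h , ¬v′g = undominated-isolated (inj₂ refl) (inj₁ refl) g≢h ¬v′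
      in ⊥-elim (no-double-swap e∈R (inj₁ refl) (inj₂ refl) g≢h v-free v′-free
                                (λ { refl → ¬v′g vg }) vg v′h)
      where
      g≢h : proj₁ e ≢ proj₂ e
      g≢h = isEdge⇒nonLoop G (isEdge e∈R)

  leafy-case : 5 ≤ length R → 1 ≤ count (deg≟ R 1) → γ≤ G (length R ∸ 2)
  leafy-case 5≤R 1≤leaves with 3 ≤? count (deg≟ R 1)
  ... | yes 3≤leaves =
    vertices-γ≤ {G = G} (deg≟ R 2) saturated-dominating (half-∸2-bound {k = length R} count-identity 3≤leaves)
  ... | no leaves≱3 =
    let e , e∈R , far = far-edge 5≤R (≤-pred (≰⇒> leaves≱3))
        g , g∈e , dominating = FarEdge.removable-endpoint e∈R far
        1+D≡saturated = count-∖ (deg≟ R 2) (FarEdge.endpoint-saturated e∈R far g∈e)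
        saturated<R = half-<-bound {k = length R} count-identity 1≤leaves
    in vertices-γ≤ {G = G} (deg≟ R 2 -ᵥ g) dominating
                   (1+m<n⇒m≤n∸2 (subst (_< length R) (sym 1+D≡saturated) saturated<R))

module NoLeaf {G : Graph n} {R} (connected : Connected G) (maximum : IsMaxTwoPacking G R)
              (noK₂ : NoK₂Component R) {e₀} (e₀∈R : e₀ ∈ R) (no-leaf : ∀ x → deg R x ≢ 1) where

  open Maximum {G = G} maximum
  open SaturatedDomination {G = G} connected maximum noK₂ e₀∈R using (isolated-saturated-neighbour)

  private
    deg≤2 : ∀ x → deg R x ≤ 2
    deg≤2 = proj₂ packing

  incident⇒saturated : ∀ {y f} → f ∈ R → Incident y f → deg R y ≡ 2
  incident⇒saturated {y} f∈R y∈f with deg R y ℕ.≟ 2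
  ... | yes y-sat = y-sat
  ... | no ¬sat   = contradiction (≤-antisym (≤2∧≢2⇒≤1 (deg≤2 y) ¬sat) (deg-pos f∈R y∈f)) (no-leaf y)

  module Swap {w a e} (w-free : deg R w ≡ 0) (wa : Adj G w a ≡ true) (e∈R : e ∈ R) (a∈e : Incident a e) where

    R′ : List (Fin n × Fin n)
    R′ = edge w a ∷ (R ─ e∈R)

    length-R′ : length R′ ≡ length R
    length-R′ = sym (length-removeAt′ R (Any.index e∈R))

    w-leaf : deg R′ w ≡ 1
    w-leaf = trans (deg-∷ (edge w a) (R ─ e∈R))
                   (cong₂ _+_ (𝟙-yes (incident? w (edge w a)) (incident-edgeˡ w a)) (deg-─-free e∈R w-free))

    a-saturated : deg R′ a ≡ 2
    a-saturated = trans (deg-∷ (edge w a) (R ─ e∈R))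
                        (cong₂ _+_ (𝟙-yes (incident? a (edge w a)) (incident-edgeʳ w a))
                                   (suc-injective (trans (deg-─-incident e∈R a∈e) (incident⇒saturated e∈R a∈e))))

    leaf-of-R′ : ∀ {f y} → f ∈ R → Incident y f → deg R′ y ≡ 1 → y ≡ other a e
    leaf-of-R′ {f} {y} f∈R y∈f y-leaf with y ≟ a
    ... | yes refl = contradiction (trans (sym a-saturated) y-leaf) λ ()
    ... | no y≢a   = other-unique a∈e y∈e y≢a
      where
      y∉wa : ¬ Incident y (edge w a)
      y∉wa y∈wa with incident-edge⁻ w a y∈wa
      ... | inj₁ y≡w = free≢incident w-free f∈R y∈f (sym y≡w)
      ... | inj₂ y≡a = y≢a y≡a
      y∈e : Incident y e
      y∈e with incident? y e
      ... | yes y∈e = y∈e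
      ... | no y∉e  = ⊥-elim (no-leaf y (trans (sym (deg-─-¬incident e∈R y∉e))
                                               (trans (sym (deg-∷-¬incident (R ─ e∈R) y∉wa)) y-leaf)))

    noK₂′ : NoK₂Component R′
    noK₂′ (here refl) d₁ d₂ with incident-edgeʳ w a
    ... | inj₁ a≡₁ = contradiction (trans (sym a-saturated) (subst (λ z → deg R′ z ≡ 1) (sym a≡₁) d₁)) λ ()
    ... | inj₂ a≡₂ = contradiction (trans (sym a-saturated) (subst (λ z → deg R′ z ≡ 1) (sym a≡₂) d₂)) λ ()
    noK₂′ (there f∈R₀) d₁ d₂ =
      let f∈R = ∈-─⁻ e∈R f∈R₀
      in isEdge⇒nonLoop G (All.lookup (proj₁ (proj₁ packing)) f∈R)
                        (trans (leaf-of-R′ f∈R (inj₁ refl) d₁) (sym (leaf-of-R′ f∈R (inj₂ refl) d₂)))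

    swap-case : 5 ≤ length R → γ≤ G (length R ∸ 2)
    swap-case 5≤R =
      subst (λ k → γ≤ G (k ∸ 2)) length-R′
            (SaturatedDomination.leafy-case {G = G} connected (swap-isMax e∈R a∈e w-free wa) noK₂′ (here refl)
                                            (subst (5 ≤_) (sym length-R′) 5≤R) (count-pos (deg≟ R′ 1) {w} w-leaf))

  isolated-case : ∀ {w} → deg R w ≡ 0 → 5 ≤ length R → γ≤ G (length R ∸ 2)
  isolated-case {w} w-free =
    let a , aw , a-saturated = isolated-saturated-neighbour w-free
        e , e∈R , a∈e = deg-pos⇒incident (subst (1 ≤_) (sym a-saturated) (s≤s z≤n))
    in Swap.swap-case w-free (trans (Graph.sym G w a) aw) e∈R a∈e

module Regular {G : Graph n} {R} (packing : IsTwoPacking G R) (regular : ∀ x → deg R x ≡ 2) where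

  order≡size : n ≡ length R
  order≡size = m+m≡n+n⇒m≡n (begin
    n + n
      ≡⟨ sym (cong₂ _+_ saturated-all saturated-all) ⟩
    count (deg≟ R 2) + count (deg≟ R 2)
      ≡⟨ sym (+-identityʳ _) ⟩
    count (deg≟ R 2) + count (deg≟ R 2) + 0
      ≡⟨ cong (count (deg≟ R 2) + count (deg≟ R 2) +_) (sym no-leaves) ⟩
    count (deg≟ R 2) + count (deg≟ R 2) + count (deg≟ R 1)
      ≡⟨ degree-count R nonLoop (λ x → ≤-reflexive (regular x)) ⟩
    length R + length R ∎)
    where
    open ≡-Reasoning
    saturated-all : count (deg≟ R 2) ≡ n
    saturated-all = count-all (deg≟ R 2) regular
    no-leaves : count (deg≟ R 1) ≡ 0
    no-leaves = count-none (deg≟ R 1) λ x leaf → contradiction (trans (sym (regular x)) leaf) λ ()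
    nonLoop : All NonLoop R
    nonLoop = All.map (isEdge⇒nonLoop G) (proj₁ (proj₁ packing))

  private
    isEdge : ∀ {e} → e ∈ R → IsEdge G e
    isEdge = All.lookup (proj₁ (proj₁ packing))

  all-but-two-dominating-at : ∀ {a c f₁ f₂} → incidentIn a R ≡ f₁ ∷ f₂ ∷ [] →
                              c ≢ a → c ≢ other a f₁ → c ≢ other a f₂ →
                              Dominating G (vertices (U? -ᵥ a -ᵥ c))
  all-but-two-dominating-at {a} {c} {f₁} {f₂} edges-at-a c≢a c≢p₁ c≢p₂ =
    all-but-two-dominating G (adj-other G (isEdge f₁∈R) a∈f₁) (λ p₁≡c → c≢p₁ (sym p₁≡c))
                             (adj-other G (isEdge f∈R) c∈f) q≢a
    where
    f₁-at-a = ∈-incidentIn⁻ R (subst (f₁ ∈_) (sym edges-at-a) (here refl))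
    f₁∈R = proj₁ f₁-at-a
    a∈f₁ = proj₂ f₁-at-a
    c-edge = deg-pos⇒incident {R = R} (subst (1 ≤_) (sym (regular c)) (s≤s z≤n))
    f = proj₁ c-edge
    f∈R = proj₁ (proj₂ c-edge)
    c∈f = proj₂ (proj₂ c-edge)
    q≢a : other c f ≢ a
    q≢a q≡a = at-a (subst (f ∈_) edges-at-a (∈-incidentIn f∈R a∈f)) (other-unique a∈f c∈f c≢a)
      where
      a∈f : Incident a f
      a∈f = subst (λ z → Incident z f) q≡a (incident-other f)
      at-a : f ∈ f₁ ∷ f₂ ∷ [] → c ≢ other a f
      at-a (here f≡f₁)         c≡ = c≢p₁ (trans c≡ (cong (other a) f≡f₁))
      at-a (there (here f≡f₂)) c≡ = c≢p₂ (trans c≡ (cong (other a) f≡f₂))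

  all-but-two-γ≤ : Fin n → 4 ≤ n → γ≤ G (n ∸ 2)
  all-but-two-γ≤ a 4≤n with deg≡2⇒two-edges {x = a} {R} (regular a)
  ... | f₁ , f₂ , edges-at-a with ∃-avoiding-three 4≤n a (other a f₁) (other a f₂)
  ...   | c , c≢a , c≢p₁ , c≢p₂ =
    vertices-γ≤ {G = G} (U? -ᵥ a -ᵥ c) (all-but-two-dominating-at edges-at-a c≢a c≢p₁ c≢p₂)
                (1+m<n⇒m≤n∸2 (≤-reflexive (count-all-but-two c≢a)))

  regular-case : 5 ≤ length R → γ≤ G (length R ∸ 2)
  regular-case 5≤R =
    subst (λ k → γ≤ G (k ∸ 2)) order≡size
          (all-but-two-γ≤ (fromℕ< (≤-trans (s≤s z≤n) 4≤n)) 4≤n)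
    where
    4≤n : 4 ≤ n
    4≤n = subst (4 ≤_) (sym order≡size) (≤-trans (n≤1+n 4) 5≤R)

domination-bound : ∀ {G : Graph n} {R e₀} → Connected G → IsMaxTwoPacking G R → NoK₂Component R →
                   e₀ ∈ R → 5 ≤ length R → γ≤ G (length R ∸ 2)
domination-bound {n} {G = G} {R} connected maximum noK₂ e₀∈R 5≤R
  with 1 ≤? count (deg≟ R 1) | Fin.any? {P = λ x → deg R x ≡ 0} (deg≟ R 0)
... | yes 1≤leaves | _                 = SaturatedDomination.leafy-case {G = G} connected maximum noK₂ e₀∈R 5≤R 1≤leaves
... | no no-leaves | yes (w , w-free) = NoLeaf.isolated-case {G = G} connected maximum noK₂ e₀∈R no-leaf w-free 5≤R
  where
  no-leaf : ∀ x → deg R x ≢ 1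
  no-leaf x leaf = no-leaves (count-pos (deg≟ R 1) leaf)
... | no no-leaves | no no-free       = Regular.regular-case {G = G} (proj₁ maximum) regular 5≤R
  where
  regular : ∀ x → deg R x ≡ 2
  regular x with deg R x in eq | proj₂ (proj₁ maximum) x
  ... | 0 | _ = contradiction (x , eq) no-free
  ... | 1 | _ = contradiction (count-pos (deg≟ R 1) eq) no-leaves
  ... | 2 | _ = refl
  ... | suc (suc (suc _)) | s≤s (s≤s ())

lemma3p4 : ∀ {n : ℕ} (G : Graph n) (R : List (Fin n × Fin n))
    → Connected G
    → IsMaxTwoPacking G R
    → length R < numEdges G
    → 5 ≤ length R
    → InducedConnected R
    → Σ (List (Fin n)) (λ D → Dominating G D × (length D ≤ length R ∸ 2))
lemma3p4 G []        _         _       _ ()  _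
lemma3p4 G (e₀ ∷ R) connected maximum _ 5≤R inducedConnected =
  domination-bound {G = G} connected maximum
    (inducedConnected⇒noK₂Component {G = G} (proj₁ maximum) (≤-trans (s≤s (s≤s z≤n)) 5≤R) inducedConnected)
    (here refl) 5≤R
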